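{- Let $p$ be a propositional variable. There is no formula $\phi\in\mathcal{L}_\blacktriangle$ that defines $\Box p$ on the class of all frames; likewise none on the class of all reflexive frames, of all symmetric frames, of all transitive frames, or of all Euclidean frames.
   Context: Formulas are built from a countable set $\mathsf{Var}$ of variables; $\mathcal{L}_\blacktriangle$ uses $\neg,\wedge,\vee,\blacktriangle$ and $\mathcal{L}_\Box$ uses $\neg,\wedge,\vee,\Box$. A frame is $\langle W,R\rangle$, $W\neq\varnothing$, $R\subseteq W^2$; a model is $\langle W,R,v^+,v^-\rangle$ with independent $v^+,v^-:\mathsf{Var}\to 2^W$; a pointed model is a model with a state. $w\vDash^+p$ iff $w\in v^+(p)$; $w\vDash^-p$ iff $w\in v^-(p)$; $\neg$ swaps $\vDash^+$ and $\vDash^-$; $\wedge$: true iff both true, false iff some false; $\vee$: true iff some true, false iff both false. $w\vDash^+\Box\phi$ iff every $R$-successor $w'$ of $w$ has $w'\vDash^+\phi$; $w\vDash^-\Box\phi$ iff some $R$-successor $w'$ has $w'\vDash^-\phi$. $w_0\vDash^+\blacktriangle\phi$ iff for all $R$-successors $w_1,w_2$ of $w_0$, ($w_1\vDash^+\phi\Rightarrow w_2\vDash^+\phi$) and ($w_1\vDash^-\phi\Rightarrow w_2\vDash^-\phi$), and every $R$-successor $w_1$ has $w_1\vDash^+\phi$ or $w_1\vDash^-\phi$. $w_0\vDash^-\blacktriangle\phi$ iff there are successors $w_1,w_2$ of $w_0$ with ($w_1\vDash^+\phi$, $w_2\nvDash^+\phi$) or ($w_1\vDash^-\phi$, $w_2\nvDash^-\phi$)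 or ($w_1\vDash^+\phi$, $w_2\vDash^-\phi$). A formula $\phi$ of one language defines a formula $\chi$ of another in a class $\mathbb{K}$ of frames iff for every $\mathfrak{F}\in\mathbb{K}$ and every pointed model $\langle\mathfrak{M},w\rangle$ on $\mathfrak{F}$: $\mathfrak{M},w\vDash^+\phi$ iff $\mathfrak{M},w\vDash^+\chi$, and $\mathfrak{M},w\vDash^-\phi$ iff $\mathfrak{M},w\vDash^-\chi$. -}

module Defs where

open import Data.Nat using (ℕ)
open import Data.Product using (Σ; _×_; ∃-syntax)
open import Data.Sum using (_⊎_)
open import Relation.Nullary using (¬_)
open import Function.Bundles using (_⇔_)
open import Level using (Level; suc; zero)

Var : Set
Var = ℕ

data Fm▲ : Set where
  var : Var → Fm▲
  ¬▲_ : Fm▲ → Fm▲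
  _∧▲_ : Fm▲ → Fm▲ → Fm▲
  _∨▲_ : Fm▲ → Fm▲ → Fm▲
  ▲_ : Fm▲ → Fm▲

data Fm□ : Set where
  var : Var → Fm□
  ¬□_ : Fm□ → Fm□
  _∧□_ : Fm□ → Fm□ → Fm□
  _∨□_ : Fm□ → Fm□ → Fm□
  □_ : Fm□ → Fm□

record Frame : Set₁ where
  field
    W : Set
    R : W → W → Set
    nonempty : W

record Model (F : Frame) : Set₁ where
  open Frame F
  field
    v⁺ : Var → W → Set
    v⁻ : Var → W → Set

module Semantics {F : Frame} (M : Model F) where
  open Frame F
  open Model M

  mutual
    _⊨▲⁺_ : W → Fm▲ → Set
    w ⊨▲⁺ var p = v⁺ p w
    w ⊨▲⁺ (¬▲ φ) = w ⊨▲⁻ φ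
    w ⊨▲⁺ (φ ∧▲ ψ) = (w ⊨▲⁺ φ) × (w ⊨▲⁺ ψ)
    w ⊨▲⁺ (φ ∨▲ ψ) = (w ⊨▲⁺ φ) ⊎ (w ⊨▲⁺ ψ)
    w₀ ⊨▲⁺ (▲ φ) =
      ((w₁ w₂ : W) → R w₀ w₁ → R w₀ w₂ →
         ((w₁ ⊨▲⁺ φ → w₂ ⊨▲⁺ φ) × (w₁ ⊨▲⁻ φ → w₂ ⊨▲⁻ φ)))
      × ((w₁ : W) → R w₀ w₁ → (w₁ ⊨▲⁺ φ) ⊎ (w₁ ⊨▲⁻ φ))

    _⊨▲⁻_ : W → Fm▲ → Set
    w ⊨▲⁻ var p = v⁻ p w
    w ⊨▲⁻ (¬▲ φ) = w ⊨▲⁺ φ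
    w ⊨▲⁻ (φ ∧▲ ψ) = (w ⊨▲⁻ φ) ⊎ (w ⊨▲⁻ ψ)
    w ⊨▲⁻ (φ ∨▲ ψ) = (w ⊨▲⁻ φ) × (w ⊨▲⁻ ψ)
    w₀ ⊨▲⁻ (▲ φ) =
      Σ W λ w₁ → Σ W λ w₂ → R w₀ w₁ × R w₀ w₂ ×
        (  ((w₁ ⊨▲⁺ φ) × ¬ (w₂ ⊨▲⁺ φ))
         ⊎ ((w₁ ⊨▲⁻ φ) × ¬ (w₂ ⊨▲⁻ φ))
         ⊎ ((w₁ ⊨▲⁺ φ) × (w₂ ⊨▲⁻ φ)))

  mutual
    _⊨□⁺_ : W → Fm□ → Set
    w ⊨□⁺ var p = v⁺ p w
    w ⊨□⁺ (¬□ φ) = w ⊨□⁻ φ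
    w ⊨□⁺ (φ ∧□ ψ) = (w ⊨□⁺ φ) × (w ⊨□⁺ ψ)
    w ⊨□⁺ (φ ∨□ ψ) = (w ⊨□⁺ φ) ⊎ (w ⊨□⁺ ψ)
    w ⊨□⁺ (□ φ) = (w' : W) → R w w' → w' ⊨□⁺ φ

    _⊨□⁻_ : W → Fm□ → Set
    w ⊨□⁻ var p = v⁻ p w
    w ⊨□⁻ (¬□ φ) = w ⊨□⁺ φ
    w ⊨□⁻ (φ ∧□ ψ) = (w ⊨□⁻ φ) ⊎ (w ⊨□⁻ ψ)
    w ⊨□⁻ (φ ∨□ ψ) = (w ⊨□⁻ φ) × (w ⊨□⁻ ψ)
    w ⊨□⁻ (□ φ) = Σ W λ w' → R w w' × (w' ⊨□⁻ φ)

FrameClass : Set₁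
FrameClass = Frame → Set

Defines : FrameClass → Fm▲ → Fm□ → Set₁
Defines K φ χ =
  (F : Frame) → K F → (M : Model F) → (w : Frame.W F) →
    let open Semantics M in
    ((w ⊨▲⁺ φ) ⇔ (w ⊨□⁺ χ)) × ((w ⊨▲⁻ φ) ⇔ (w ⊨□⁻ χ))

AllFrames : FrameClass
AllFrames F = Data.Unit.⊤
  where import Data.Unit

Reflexive : FrameClass
Reflexive F = (w : W) → R w w
  where open Frame F

Symmetric : FrameClass
Symmetric F = (w u : W) → R w u → R u w
  where open Frame F

Transitive : FrameClass
Transitive F = (w u v : W) → R w u → R u v → R w v
  where open Frame F

Euclidean : FrameClass
Euclidean F = (w u v : W) → R w u → R w v → R u v
  where open Frame F

{-# OPTIONS --safe #-}
module Submission where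

open import Defs
open import Data.Bool using (Bool; true; false; T; _∧_; _∨_)
open import Data.Bool.Properties using (T-∧; T-∨)
open import Data.Empty using (⊥-elim)
open import Data.Product using (_×_; _,_; proj₁; proj₂; ∃-syntax)
open import Data.Product.Function.NonDependent.Propositional using (_×-⇔_)
open import Data.Sum using (_⊎_; inj₁; inj₂)
open import Data.Sum.Function.Propositional using (_⊎-⇔_)
open import Data.Unit using (⊤; tt)
open import Function.Bundles using (_⇔_; mk⇔; module Equivalence)
open import Function.Construct.Composition using (_⇔-∘_)
open import Function.Construct.Identity using (⇔-id)
open import Function.Construct.Symmetry using (⇔-sym)
open import Relation.Binary.PropositionalEquality using (_≡_; _≢_; refl)
open import Relation.Nullary using (¬_)

open Equivalence using (to; from)

-- Two models on the two-point universal frame agree that p is told true (only) at the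
-- point true; at the point false, p is a glut in one model and a gap in the other, so
-- □ p is true at true in the first model and not in the second. Every ▲-formula, however,
-- takes the same classical value at true in both models: at false its two values are
-- related by 𝐓∼𝐓, 𝐅∼𝐅, 𝐁∼𝐍, a relation preserved by the Belnap connectives, and ▲ φ is
-- 𝐓 everywhere when φ is constant and 𝐅 everywhere when it takes two distinct values,
-- whether the second one is classical, a glut or a gap.

record Belnap : Set where
  constructor ⟨_,_⟩
  field
    told-true told-false : Bool
open Belnap

𝐓 𝐅 𝐁 𝐍 : Belnap
𝐓 = ⟨ true , false ⟩
𝐅 = ⟨ false , true ⟩
𝐁 = ⟨ true , true ⟩
𝐍 = ⟨ false , false ⟩

¬ᴮ_ : Belnap → Belnap
¬ᴮ u = ⟨ told-false u , told-true u ⟩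

_∧ᴮ_ : Belnap → Belnap → Belnap
u ∧ᴮ v = ⟨ told-true u ∧ told-true v , told-false u ∨ told-false v ⟩

_∨ᴮ_ : Belnap → Belnap → Belnap
u ∨ᴮ v = ⟨ told-true u ∨ told-true v , told-false u ∧ told-false v ⟩

data GlutGap : Belnap → Belnap → Set where
  𝐓∼𝐓 : GlutGap 𝐓 𝐓
  𝐅∼𝐅 : GlutGap 𝐅 𝐅
  𝐁∼𝐍 : GlutGap 𝐁 𝐍

Classical : Belnap → Set
Classical c = GlutGap c c

GlutGap-¬ : ∀ {u v} → GlutGap u v → GlutGap (¬ᴮ u) (¬ᴮ v)
GlutGap-¬ 𝐓∼𝐓 = 𝐅∼𝐅
GlutGap-¬ 𝐅∼𝐅 = 𝐓∼𝐓
GlutGap-¬ 𝐁∼𝐍 = 𝐁∼𝐍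

GlutGap-∧ : ∀ {u v u′ v′} → GlutGap u v → GlutGap u′ v′ → GlutGap (u ∧ᴮ u′) (v ∧ᴮ v′)
GlutGap-∧ 𝐓∼𝐓 r   = r
GlutGap-∧ 𝐅∼𝐅 _   = 𝐅∼𝐅
GlutGap-∧ 𝐁∼𝐍 𝐓∼𝐓 = 𝐁∼𝐍
GlutGap-∧ 𝐁∼𝐍 𝐅∼𝐅 = 𝐅∼𝐅
GlutGap-∧ 𝐁∼𝐍 𝐁∼𝐍 = 𝐁∼𝐍

GlutGap-∨ : ∀ {u v u′ v′} → GlutGap u v → GlutGap u′ v′ → GlutGap (u ∨ᴮ u′) (v ∨ᴮ v′)
GlutGap-∨ 𝐓∼𝐓 _   = 𝐓∼𝐓
GlutGap-∨ 𝐅∼𝐅 r   = r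
GlutGap-∨ 𝐁∼𝐍 𝐓∼𝐓 = 𝐓∼𝐓
GlutGap-∨ 𝐁∼𝐍 𝐅∼𝐅 = 𝐁∼𝐍
GlutGap-∨ 𝐁∼𝐍 𝐁∼𝐍 = 𝐁∼𝐍

constant-or-distinct : ∀ {c u v} → Classical c → GlutGap u v →
                       (c ≡ u × c ≡ v) ⊎ (c ≢ u × c ≢ v)
constant-or-distinct 𝐓∼𝐓 𝐓∼𝐓 = inj₁ (refl , refl)
constant-or-distinct 𝐓∼𝐓 𝐅∼𝐅 = inj₂ ((λ ()) , (λ ()))
constant-or-distinct 𝐓∼𝐓 𝐁∼𝐍 = inj₂ ((λ ()) , (λ ()))
constant-or-distinct 𝐅∼𝐅 𝐓∼𝐓 = inj₂ ((λ ()) , (λ ()))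
constant-or-distinct 𝐅∼𝐅 𝐅∼𝐅 = inj₁ (refl , refl)
constant-or-distinct 𝐅∼𝐅 𝐁∼𝐍 = inj₂ ((λ ()) , (λ ()))

belnapModel : {F : Frame} → (Var → Frame.W F → Belnap) → Model F
belnapModel V = record
  { v⁺ = λ q w → T (told-true (V q w))
  ; v⁻ = λ q w → T (told-false (V q w))
  }

record HasValue {F : Frame} (M : Model F) (w : Frame.W F) (φ : Fm▲) (v : Belnap) : Set where
  field
    positive : Semantics._⊨▲⁺_ M w φ ⇔ T (told-true v)
    negative : Semantics._⊨▲⁻_ M w φ ⇔ T (told-false v)
open HasValue

module _ {F : Frame} where
  open Frame F

  var-value : ∀ (V : Var → W → Belnap) {w} q → HasValue (belnapModel {F} V) w (var q) (V q w)
  var-value V q = record { positive = ⇔-id _ ; negative = ⇔-id _ }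

  module _ {M : Model F} where
    open Semantics M

    ¬▲-value : ∀ {w φ u} → HasValue M w φ u → HasValue M w (¬▲ φ) (¬ᴮ u)
    ¬▲-value h = record { positive = negative h ; negative = positive h }

    ∧▲-value : ∀ {w φ ψ u v} → HasValue M w φ u → HasValue M w ψ v →
               HasValue M w (φ ∧▲ ψ) (u ∧ᴮ v)
    ∧▲-value h k = record
      { positive = ⇔-sym T-∧ ⇔-∘ (positive h ×-⇔ positive k)
      ; negative = ⇔-sym T-∨ ⇔-∘ (negative h ⊎-⇔ negative k)
      }

    ∨▲-value : ∀ {w φ ψ u v} → HasValue M w φ u → HasValue M w ψ v →
               HasValue M w (φ ∨▲ ψ) (u ∨ᴮ v)
    ∨▲-value h k = record
      { positive = ⇔-sym T-∨ ⇔-∘ (positive h ⊎-⇔ positive k)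
      ; negative = ⇔-sym T-∧ ⇔-∘ (negative h ×-⇔ negative k)
      }

    𝐓-value : ∀ {w φ} → w ⊨▲⁺ φ → ¬ w ⊨▲⁻ φ → HasValue M w φ 𝐓
    𝐓-value s n = record { positive = mk⇔ _ λ _ → s ; negative = mk⇔ n ⊥-elim }

    𝐅-value : ∀ {w φ} → ¬ w ⊨▲⁺ φ → w ⊨▲⁻ φ → HasValue M w φ 𝐅
    𝐅-value n s = record { positive = mk⇔ n ⊥-elim ; negative = mk⇔ _ λ _ → s }

    ▲-value-of-constant : ∀ {w₀ φ c} → Classical c →
                          (∀ w → R w₀ w → HasValue M w φ c) → HasValue M w₀ (▲ φ) 𝐓
    ▲-value-of-constant {w₀} {φ} 𝐓∼𝐓 h = 𝐓-value
      ( (λ w₁ w₂ r₁ r₂ → (λ _ → from (positive (h w₂ r₂)) tt) ,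
                         (λ s → ⊥-elim (to (negative (h w₁ r₁)) s)))
      , (λ w r → inj₁ (from (positive (h w r)) tt)) )
      not-refuted
      where
      not-refuted : ¬ w₀ ⊨▲⁻ (▲ φ)
      not-refuted (_ , w₂ , _ , r₂ , inj₁ (_ , n))          = n (from (positive (h w₂ r₂)) tt)
      not-refuted (w₁ , _ , r₁ , _ , inj₂ (inj₁ (s , _)))   = to (negative (h w₁ r₁)) s
      not-refuted (_ , w₂ , _ , r₂ , inj₂ (inj₂ (_ , s)))   = to (negative (h w₂ r₂)) s
    ▲-value-of-constant {w₀} {φ} 𝐅∼𝐅 h = 𝐓-value
      ( (λ w₁ w₂ r₁ r₂ → (λ s → ⊥-elim (to (positive (h w₁ r₁)) s)) ,
                         (λ _ → from (negative (h w₂ r₂)) tt))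
      , (λ w r → inj₂ (from (negative (h w r)) tt)) )
      not-refuted
      where
      not-refuted : ¬ w₀ ⊨▲⁻ (▲ φ)
      not-refuted (w₁ , _ , r₁ , _ , inj₁ (s , _))          = to (positive (h w₁ r₁)) s
      not-refuted (_ , w₂ , _ , r₂ , inj₂ (inj₁ (_ , n)))   = n (from (negative (h w₂ r₂)) tt)
      not-refuted (w₁ , _ , r₁ , _ , inj₂ (inj₂ (s , _)))   = to (positive (h w₁ r₁)) s

    ▲-refuted-by-told-true : ∀ {w₀ w₁ w₂ φ} → R w₀ w₁ → R w₀ w₂ →
                             w₁ ⊨▲⁺ φ → ¬ w₂ ⊨▲⁺ φ → HasValue M w₀ (▲ φ) 𝐅
    ▲-refuted-by-told-true {w₁ = w₁} {w₂} r₁ r₂ s n =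
      𝐅-value (λ (agree , _) → n (proj₁ (agree w₁ w₂ r₁ r₂) s))
              (w₁ , w₂ , r₁ , r₂ , inj₁ (s , n))

    ▲-refuted-by-told-false : ∀ {w₀ w₁ w₂ φ} → R w₀ w₁ → R w₀ w₂ →
                              w₁ ⊨▲⁻ φ → ¬ w₂ ⊨▲⁻ φ → HasValue M w₀ (▲ φ) 𝐅
    ▲-refuted-by-told-false {w₁ = w₁} {w₂} r₁ r₂ s n =
      𝐅-value (λ (agree , _) → n (proj₂ (agree w₁ w₂ r₁ r₂) s))
              (w₁ , w₂ , r₁ , r₂ , inj₂ (inj₁ (s , n)))

    ▲-value-of-distinct : ∀ {w₀ w₁ w₂ φ u v} → R w₀ w₁ → R w₀ w₂ →
                          HasValue M w₁ φ u → HasValue M w₂ φ v → u ≢ v →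
                          HasValue M w₀ (▲ φ) 𝐅
    ▲-value-of-distinct {u = ⟨ true , _ ⟩} {⟨ false , _ ⟩} r₁ r₂ h₁ h₂ _ =
      ▲-refuted-by-told-true r₁ r₂ (from (positive h₁) tt) (to (positive h₂))
    ▲-value-of-distinct {u = ⟨ false , _ ⟩} {⟨ true , _ ⟩} r₁ r₂ h₁ h₂ _ =
      ▲-refuted-by-told-true r₂ r₁ (from (positive h₂) tt) (to (positive h₁))
    ▲-value-of-distinct {u = ⟨ _ , true ⟩} {⟨ _ , false ⟩} r₁ r₂ h₁ h₂ _ =
      ▲-refuted-by-told-false r₁ r₂ (from (negative h₁) tt) (to (negative h₂))
    ▲-value-of-distinct {u = ⟨ _ , false ⟩} {⟨ _ , true ⟩} r₁ r₂ h₁ h₂ _ =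
      ▲-refuted-by-told-false r₂ r₁ (from (negative h₂) tt) (to (negative h₁))
    ▲-value-of-distinct {u = ⟨ true , true ⟩}   {⟨ true , true ⟩}   _ _ _ _ u≢v = ⊥-elim (u≢v refl)
    ▲-value-of-distinct {u = ⟨ true , false ⟩}  {⟨ true , false ⟩}  _ _ _ _ u≢v = ⊥-elim (u≢v refl)
    ▲-value-of-distinct {u = ⟨ false , true ⟩}  {⟨ false , true ⟩}  _ _ _ _ u≢v = ⊥-elim (u≢v refl)
    ▲-value-of-distinct {u = ⟨ false , false ⟩} {⟨ false , false ⟩} _ _ _ _ u≢v = ⊥-elim (u≢v refl)

universal : Frame
universal = record { W = Bool ; R = λ _ _ → ⊤ ; nonempty = true }

data Side : Set where
  glut gap : Side

atomValue : Side → Bool → Belnap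
atomValue _    true  = 𝐓
atomValue glut false = 𝐁
atomValue gap  false = 𝐍

model : Side → Model universal
model s = belnapModel {universal} λ _ → atomValue s

record Invariant (φ : Fm▲) : Set where
  field
    {c u v}       : Belnap
    classical     : Classical c
    glut∼gap      : GlutGap u v
    at-true       : ∀ s → HasValue (model s) true φ c
    at-false-glut : HasValue (model glut) false φ u
    at-false-gap  : HasValue (model gap) false φ v
open Invariant

uniform-invariant : ∀ {ψ c} → Classical c → (∀ s w → HasValue (model s) w ψ c) → Invariant ψ
uniform-invariant cl h = record
  { classical = cl ; glut∼gap = cl
  ; at-true = λ s → h s true ; at-false-glut = h glut false ; at-false-gap = h gap false
  }

var-invariant : ∀ q → Invariant (var q)
var-invariant q = record
  { classical = 𝐓∼𝐓 ; glut∼gap = 𝐁∼𝐍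
  ; at-true = λ s → var-value (λ _ → atomValue s) q
  ; at-false-glut = var-value (λ _ → atomValue glut) q
  ; at-false-gap = var-value (λ _ → atomValue gap) q
  }

¬▲-invariant : ∀ {φ} → Invariant φ → Invariant (¬▲ φ)
¬▲-invariant i = record
  { classical = GlutGap-¬ (classical i) ; glut∼gap = GlutGap-¬ (glut∼gap i)
  ; at-true = λ s → ¬▲-value (at-true i s)
  ; at-false-glut = ¬▲-value (at-false-glut i)
  ; at-false-gap = ¬▲-value (at-false-gap i)
  }

∧▲-invariant : ∀ {φ ψ} → Invariant φ → Invariant ψ → Invariant (φ ∧▲ ψ)
∧▲-invariant i j = record
  { classical = GlutGap-∧ (classical i) (classical j)
  ; glut∼gap = GlutGap-∧ (glut∼gap i) (glut∼gap j)
  ; at-true = λ s → ∧▲-value (at-true i s) (at-true j s)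
  ; at-false-glut = ∧▲-value (at-false-glut i) (at-false-glut j)
  ; at-false-gap = ∧▲-value (at-false-gap i) (at-false-gap j)
  }

∨▲-invariant : ∀ {φ ψ} → Invariant φ → Invariant ψ → Invariant (φ ∨▲ ψ)
∨▲-invariant i j = record
  { classical = GlutGap-∨ (classical i) (classical j)
  ; glut∼gap = GlutGap-∨ (glut∼gap i) (glut∼gap j)
  ; at-true = λ s → ∨▲-value (at-true i s) (at-true j s)
  ; at-false-glut = ∨▲-value (at-false-glut i) (at-false-glut j)
  ; at-false-gap = ∨▲-value (at-false-gap i) (at-false-gap j)
  }

▲-invariant : ∀ {φ} → Invariant φ → Invariant (▲ φ)
▲-invariant {φ} i with constant-or-distinct (classical i) (glut∼gap i)
... | inj₁ (refl , refl) = uniform-invariant 𝐓∼𝐓 λ s _ → ▲-value-of-constant (classical i) (at s)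
  where
  at : ∀ s w → ⊤ → HasValue (model s) w φ (c i)
  at s    true  _ = at-true i s
  at glut false _ = at-false-glut i
  at gap  false _ = at-false-gap i
... | inj₂ (c≢u , c≢v) = uniform-invariant 𝐅∼𝐅 λ
  { glut _ → ▲-value-of-distinct {w₁ = true} {false} tt tt (at-true i glut) (at-false-glut i) c≢u
  ; gap  _ → ▲-value-of-distinct {w₁ = true} {false} tt tt (at-true i gap) (at-false-gap i) c≢v
  }

invariant : ∀ φ → Invariant φ
invariant (var q)  = var-invariant q
invariant (¬▲ φ)   = ¬▲-invariant (invariant φ)
invariant (φ ∧▲ ψ) = ∧▲-invariant (invariant φ) (invariant ψ)
invariant (φ ∨▲ ψ) = ∨▲-invariant (invariant φ) (invariant ψ)
invariant (▲ φ)    = ▲-invariant (invariant φ)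

□-undefinable : (K : FrameClass) → K universal → (p : Var) → ¬ (∃[ φ ] Defines K φ (□ var p))
□-undefinable K universal∈K p (φ , defines) =
  to (φ⇔□p gap) (glut⇒gap (from (φ⇔□p glut) glut⊨□p)) false tt
  where
  φ⇔□p : ∀ s → Semantics._⊨▲⁺_ (model s) true φ ⇔ Semantics._⊨□⁺_ (model s) true (□ var p)
  φ⇔□p s = proj₁ (defines universal universal∈K (model s) true)

  glut⇒gap : Semantics._⊨▲⁺_ (model glut) true φ → Semantics._⊨▲⁺_ (model gap) true φ
  glut⇒gap s = from (positive (at-true (invariant φ) gap))
                    (to (positive (at-true (invariant φ) glut)) s)

  glut⊨□p : Semantics._⊨□⁺_ (model glut) true (□ var p)
  glut⊨□p true  _ = tt
  glut⊨□p false _ = tt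

theorem5 : (p : Var) →
    (¬ (∃[ φ ] Defines AllFrames φ (□ var p)))
    × (¬ (∃[ φ ] Defines Reflexive φ (□ var p)))
    × (¬ (∃[ φ ] Defines Symmetric φ (□ var p)))
    × (¬ (∃[ φ ] Defines Transitive φ (□ var p)))
    × (¬ (∃[ φ ] Defines Euclidean φ (□ var p)))
theorem5 p =
  □-undefinable AllFrames tt p ,
  □-undefinable Reflexive (λ _ → tt) p ,
  □-undefinable Symmetric (λ _ _ _ → tt) p ,
  □-undefinable Transitive (λ _ _ _ _ _ → tt) p ,
  □-undefinable Euclidean (λ _ _ _ _ _ → tt) p
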